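{- Let $d\ge1$, $\pi\in\mathbb{Z}^d_{>0}$, $T$ a positive integer, and $Q=\mathbb{Z}^d\cap\{c\in\mathbb{R}^d_{\ge 0}:\pi\cdot c\le T\}$. Every vertex of $\mathrm{conv}(Q)$ is a simple configuration. Moreover, the total number of simple configurations in $Q$ is at most $2^{O(\log^2(T)+\log^2(d))}$, and hence the number of vertices of $\mathrm{conv}(Q)$ is also at most $2^{O(\log^2(T)+\log^2(d))}$.
   Context: $\log=\log_2$; $\mathrm{supp}(a)=\{i:a_i\ne 0\}$. Elements of $Q$ are configurations; $c\in Q$ is simple if $|\mathrm{supp}(c)|\le\log(T+1)$ and complex otherwise. -}

module Defs where

open import Data.Nat using (ℕ; zero; suc; _+_; _*_; _^_; _≤_)
open import Data.Nat.Logarithm using (⌈log₂_⌉)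
open import Data.Integer using (+_)
open import Data.Rational using (ℚ; 0ℚ; 1ℚ) renaming (_+_ to _+ℚ_; _*_ to _*ℚ_; _≤_ to _≤ℚ_; _/_ to _/ℚ_)
open import Data.Fin using (Fin)
open import Data.Vec using (Vec; []; _∷_; lookup; replicate; zipWith; map)
open import Data.List using (List; length)
open import Data.List.Relation.Unary.All using (All)
open import Data.List.Relation.Unary.Unique.Propositional using (Unique)
open import Data.Product using (_×_; _,_; Σ)
open import Relation.Binary.PropositionalEquality using (_≡_; _≢_)
open import Relation.Nullary using (¬_)

dot : ∀ {d} → Vec ℕ d → Vec ℕ d → ℕ
dot [] [] = 0
dot (x ∷ xs) (y ∷ ys) = x * y + dot xs ys

Positive : ∀ {d} → Vec ℕ d → Set
Positive {d} π = (i : Fin d) → 1 ≤ lookup π i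

-- c ∈ Q  :=  c ∈ ℤ^d_{≥0} (encoded as Vec ℕ d) with π·c ≤ T
InQ : ∀ {d} → Vec ℕ d → ℕ → Vec ℕ d → Set
InQ π T c = dot π c ≤ T

suppSize : ∀ {d} → Vec ℕ d → ℕ
suppSize [] = 0
suppSize (zero ∷ xs) = suppSize xs
suppSize (suc _ ∷ xs) = suc (suppSize xs)

-- simple: |supp c| ≤ log₂(T+1), equivalently 2^|supp c| ≤ T+1
Simple : ∀ {d} → ℕ → Vec ℕ d → Set
Simple T c = 2 ^ suppSize c ≤ T + 1

toℚ : ℕ → ℚ
toℚ n = (+ n) /ℚ 1

toℚv : ∀ {d} → Vec ℕ d → Vec ℚ d
toℚv = map toℚ

sumW : ∀ {d} → List (ℚ × Vec ℕ d) → ℚ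
sumW List.[] = 0ℚ
sumW ((w , _) List.∷ xs) = w +ℚ sumW xs

combo : ∀ {d} → List (ℚ × Vec ℕ d) → Vec ℚ d
combo {d} List.[] = replicate d 0ℚ
combo ((w , p) List.∷ xs) = zipWith _+ℚ_ (map (w *ℚ_) (toℚv p)) (combo xs)

ConvCombOfOthers : ∀ {d} → Vec ℕ d → ℕ → Vec ℕ d → Set
ConvCombOfOthers {d} π T c =
  Σ (List (ℚ × Vec ℕ d)) λ xs →
    All (λ wp → (0ℚ ≤ℚ Data.Product.proj₁ wp) × InQ π T (Data.Product.proj₂ wp) × (Data.Product.proj₂ wp ≢ c)) xs
    × sumW xs ≡ 1ℚ
    × combo xs ≡ toℚv c

-- vertex (extreme point) of conv(Q): c ∈ Q and c ∉ conv(Q ∖ {c})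
IsVertex : ∀ {d} → Vec ℕ d → ℕ → Vec ℕ d → Set
IsVertex π T c = InQ π T c × ¬ ConvCombOfOthers π T c

bound : ℕ → ℕ → ℕ → ℕ
bound C T d = 2 ^ (C * (⌈log₂ T ⌉ * ⌈log₂ T ⌉ + ⌈log₂ d ⌉ * ⌈log₂ d ⌉ + 1))

-- number of elements satisfying P is at most B: every duplicate-free list of such elements has length ≤ B
AtMost : ∀ {d} → (Vec ℕ d → Set) → ℕ → Set
AtMost {d} P B = (L : List (Vec ℕ d)) → Unique L → All P L → length L ≤ B

-- If two distinct 0/1 vectors x, y supported on supp c had the same π-value, c would be
-- the midpoint of the two points c − y + x and c − x + y of Q, so c is not a vertex.
-- Hence at a vertex the 2^|supp c| such vectors have distinct π-values in {0, …, T},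
-- giving 2^|supp c| ≤ T + 1. Since π is positive, the entries of a configuration are at
-- most T, so configurations with support at most k = 1 + ⌈log₂ T⌉ number at most
-- (1 + d T)^k ≤ 2^(4 (⌈log₂ T⌉² + ⌈log₂ d⌉² + 1)).
module Submission where

open import Defs
open import Data.Empty using (⊥-elim)
import Data.Fin as Fin
import Data.Integer as ℤ
import Data.Integer.Properties as ℤ
open import Data.List using (List; []; _∷_; [_]; length; map; _++_; upTo; cartesianProductWith)
open import Data.List.Properties using (length-map; length-++; length-upTo; length-removeAt′)
open import Data.List.Membership.Propositional using (_∈_)
open import Data.List.Membership.Propositional.Properties
  using (∈-map⁺; ∈-map⁻; ∈-++⁺ˡ; ∈-++⁺ʳ; ∈-upTo⁺; ∈-cartesianProductWith⁺; ∈-cartesianProductWith⁻)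
open import Data.List.Relation.Binary.Subset.Propositional using (_⊆_)
open import Data.List.Relation.Unary.All as All using (All; []; _∷_)
import Data.List.Relation.Unary.All.Properties as All
open import Data.List.Relation.Unary.AllPairs using ([]; _∷_)
open import Data.List.Relation.Unary.Any using (here; there; _─_)
open import Data.List.Relation.Unary.Unique.Propositional using (Unique)
import Data.List.Relation.Unary.Unique.Propositional.Properties as Unique
open import Data.Nat using (ℕ; zero; suc; _+_; _*_; _∸_; _^_; _≤_; _<_; z≤n; s≤s; _≟_; ⌈_/2⌉)
open import Data.Nat.Coprimality using (1-coprimeTo) renaming (sym to coprime-sym)
open import Data.Nat.Induction using (<-wellFounded)
open import Data.Nat.Logarithm using (⌈log₂_⌉)
open import Data.Nat.Logarithm.Core using (⌈log2⌉)
open import Data.Nat.Properties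
open import Data.Nat.Solver using (module +-*-Solver)
open import Data.Product using (Σ; _×_; _,_; proj₁)
open import Data.Rational using (0ℚ; 1ℚ; ½)
  renaming (_+_ to _+ℚ_; _*_ to _*ℚ_; _≤_ to _≤ℚ_; _≤?_ to _≤ℚ?_)
import Data.Rational.Properties as ℚ
open import Data.Sum using (inj₁; inj₂)
open import Data.Vec using (Vec; []; _∷_; zipWith)
open import Data.Vec.Properties using (∷-injective; ∷-injectiveˡ; ∷-injectiveʳ; ≡-dec)
open import Data.Vec.Relation.Binary.Pointwise.Inductive using (Pointwise; []; _∷_)
open import Data.Vec.Relation.Unary.All as Vecᴬ using ([]; _∷_)
open import Function using (_∘_)
open import Induction.WellFounded using (Acc; acc)
open import Relation.Binary.PropositionalEquality hiding ([_])
open import Relation.Nullary using (yes; no)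
open import Relation.Nullary.Decidable using (toWitness)
open import Algebra.Properties.CommutativeSemigroup +-commutativeSemigroup
  using () renaming (interchange to +-interchange)
open +-*-Solver using (solve; _:=_; _:+_; _:*_; con)

private
  variable
    d : ℕ

module _ {A : Set} where

  ∈-─ : ∀ {x y : A} {xs} (x∈xs : x ∈ xs) → y ∈ xs → y ≢ x → y ∈ (xs ─ x∈xs)
  ∈-─ (here refl)  (here refl)  y≢x = ⊥-elim (y≢x refl)
  ∈-─ (here refl)  (there y∈xs) _   = y∈xs
  ∈-─ (there _)    (here refl)  _   = here refl
  ∈-─ (there x∈xs) (there y∈xs) y≢x = there (∈-─ x∈xs y∈xs y≢x)

  Unique∧⊆⇒length≤ : {xs ys : List A} → Unique xs → xs ⊆ ys → length xs ≤ length ys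
  Unique∧⊆⇒length≤ [] _ = z≤n
  Unique∧⊆⇒length≤ {x ∷ xs} {ys} (x∉xs ∷ xs!) xs⊆ys =
    subst (suc (length xs) ≤_) (sym (length-removeAt′ ys _))
      (s≤s (Unique∧⊆⇒length≤ xs! λ y∈xs →
        ∈-─ x∈ys (xs⊆ys (there y∈xs)) λ y≡x → All.lookup x∉xs y∈xs (sym y≡x)))
    where x∈ys = xs⊆ys (here refl)

  Unique-map⁺-injectiveOn : ∀ {B : Set} {f : A → B} {xs} →
    (∀ {x y} → x ∈ xs → y ∈ xs → f x ≡ f y → x ≡ y) → Unique xs → Unique (map f xs)
  Unique-map⁺-injectiveOn _ [] = []
  Unique-map⁺-injectiveOn inj (x∉xs ∷ xs!) =
    All.map⁺ (All.tabulate λ y∈xs fx≡fy → All.lookup x∉xs y∈xs (inj (here refl) (there y∈xs) fx≡fy))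
    ∷ Unique-map⁺-injectiveOn (λ x∈ y∈ → inj (there x∈) (there y∈)) xs!

length-cartesianProductWith : ∀ {A B C : Set} (f : A → B → C) xs ys →
  length (cartesianProductWith f xs ys) ≡ length xs * length ys
length-cartesianProductWith f [] ys = refl
length-cartesianProductWith f (x ∷ xs) ys = begin
  length (map (f x) ys ++ cartesianProductWith f xs ys)          ≡⟨ length-++ (map (f x) ys) ⟩
  length (map (f x) ys) + length (cartesianProductWith f xs ys)  ≡⟨ cong₂ _+_ (length-map (f x) ys)
                                                                     (length-cartesianProductWith f xs ys) ⟩
  length ys + length xs * length ys                               ∎
  where open ≡-Reasoning

toℚ-suc : ∀ n → toℚ (suc n) ≡ 1ℚ +ℚ toℚ n
toℚ-suc n
  rewrite ℚ.normalize-coprime {n} {0} (coprime-sym (1-coprimeTo n))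
        | ℤ.*-identityʳ (ℤ.+ n)
        = refl

toℚ-+ : ∀ m n → toℚ (m + n) ≡ toℚ m +ℚ toℚ n
toℚ-+ zero    n = sym (ℚ.+-identityˡ (toℚ n))
toℚ-+ (suc m) n = begin
  toℚ (suc (m + n))          ≡⟨ toℚ-suc (m + n) ⟩
  1ℚ +ℚ toℚ (m + n)          ≡⟨ cong (1ℚ +ℚ_) (toℚ-+ m n) ⟩
  1ℚ +ℚ (toℚ m +ℚ toℚ n)     ≡⟨ ℚ.+-assoc 1ℚ (toℚ m) (toℚ n) ⟨
  (1ℚ +ℚ toℚ m) +ℚ toℚ n     ≡⟨ cong (_+ℚ toℚ n) (toℚ-suc m) ⟨
  toℚ (suc m) +ℚ toℚ n       ∎
  where open ≡-Reasoning

-- The trailing 0ℚ is the empty tail of combo.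
½-average : ∀ a b c → a + b ≡ c + c → ½ *ℚ toℚ a +ℚ (½ *ℚ toℚ b +ℚ 0ℚ) ≡ toℚ c
½-average a b c a+b≡c+c = begin
  ½ *ℚ toℚ a +ℚ (½ *ℚ toℚ b +ℚ 0ℚ) ≡⟨ cong (½ *ℚ toℚ a +ℚ_) (ℚ.+-identityʳ (½ *ℚ toℚ b)) ⟩
  ½ *ℚ toℚ a +ℚ ½ *ℚ toℚ b         ≡⟨ ℚ.*-distribˡ-+ ½ (toℚ a) (toℚ b) ⟨
  ½ *ℚ (toℚ a +ℚ toℚ b)            ≡⟨ cong (½ *ℚ_) (toℚ-+ a b) ⟨
  ½ *ℚ toℚ (a + b)                 ≡⟨ cong (λ n → ½ *ℚ toℚ n) a+b≡c+c ⟩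
  ½ *ℚ toℚ (c + c)                 ≡⟨ cong (½ *ℚ_) (toℚ-+ c c) ⟩
  ½ *ℚ (toℚ c +ℚ toℚ c)            ≡⟨ ℚ.*-distribˡ-+ ½ (toℚ c) (toℚ c) ⟩
  ½ *ℚ toℚ c +ℚ ½ *ℚ toℚ c         ≡⟨ ℚ.*-distribʳ-+ (toℚ c) ½ ½ ⟨
  1ℚ *ℚ toℚ c                      ≡⟨ ℚ.*-identityˡ (toℚ c) ⟩
  toℚ c                            ∎
  where open ≡-Reasoning

midpoint-combo : (u v c : Vec ℕ d) → zipWith _+_ u v ≡ zipWith _+_ c c →
  combo ((½ , u) ∷ (½ , v) ∷ []) ≡ toℚv c
midpoint-combo [] [] [] _ = refl
midpoint-combo (a ∷ u) (b ∷ v) (c ∷ cs) eq =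
  cong₂ _∷_ (½-average a b c (∷-injectiveˡ eq)) (midpoint-combo u v cs (∷-injectiveʳ eq))

-- Exchanging a part of a configuration

_≤ᵛ_ : Vec ℕ d → Vec ℕ d → Set
_≤ᵛ_ = Pointwise _≤_

exchange : Vec ℕ d → Vec ℕ d → Vec ℕ d → Vec ℕ d
exchange c y x = zipWith _+_ (zipWith _∸_ c y) x

dot-zipWith-+ : (π u v : Vec ℕ d) → dot π (zipWith _+_ u v) ≡ dot π u + dot π v
dot-zipWith-+ [] [] [] = refl
dot-zipWith-+ (p ∷ π) (a ∷ u) (b ∷ v)
  rewrite dot-zipWith-+ π u v | *-distribˡ-+ p a b = +-interchange (p * a) (p * b) (dot π u) (dot π v)

dot-monoʳ-≤ : (π : Vec ℕ d) {x c : Vec ℕ d} → x ≤ᵛ c → dot π x ≤ dot π c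
dot-monoʳ-≤ []      []            = z≤n
dot-monoʳ-≤ (p ∷ π) (x≤c ∷ xs≤cs) = +-mono-≤ (*-monoʳ-≤ p x≤c) (dot-monoʳ-≤ π xs≤cs)

zipWith-∸-+-cancel : {c y : Vec ℕ d} → y ≤ᵛ c → zipWith _+_ (zipWith _∸_ c y) y ≡ c
zipWith-∸-+-cancel []            = refl
zipWith-∸-+-cancel (y≤c ∷ ys≤cs) = cong₂ _∷_ (m∸n+n≡m y≤c) (zipWith-∸-+-cancel ys≤cs)

dot-exchange : (π : Vec ℕ d) {c x y : Vec ℕ d} → y ≤ᵛ c → dot π x ≡ dot π y →
  dot π (exchange c y x) ≡ dot π c
dot-exchange π {c} {x} {y} y≤c πx≡πy = begin
  dot π (exchange c y x)                        ≡⟨ dot-zipWith-+ π c∸y x ⟩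
  dot π c∸y + dot π x                           ≡⟨ cong (_+_ (dot π c∸y)) πx≡πy ⟩
  dot π c∸y + dot π y                           ≡⟨ dot-zipWith-+ π c∸y y ⟨
  dot π (zipWith _+_ c∸y y)                     ≡⟨ cong (dot π) (zipWith-∸-+-cancel y≤c) ⟩
  dot π c                                       ∎
  where
  open ≡-Reasoning
  c∸y = zipWith _∸_ c y

exchange-injective : {c x y : Vec ℕ d} → y ≤ᵛ c → exchange c y x ≡ c → x ≡ y
exchange-injective {c = []} {[]} [] _ = refl
exchange-injective {c = c ∷ _} {x ∷ _} {y ∷ _} (y≤c ∷ ys≤cs) eq =
  cong₂ _∷_ (+-cancelˡ-≡ (c ∸ y) x y (trans (∷-injectiveˡ eq) (sym (m∸n+n≡m y≤c))))
            (exchange-injective ys≤cs (∷-injectiveʳ eq))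

exchange-sum : {c x y : Vec ℕ d} → x ≤ᵛ c → y ≤ᵛ c →
  zipWith _+_ (exchange c y x) (exchange c x y) ≡ zipWith _+_ c c
exchange-sum {c = []} {[]} {[]} [] [] = refl
exchange-sum {c = c ∷ _} {x ∷ _} {y ∷ _} (x≤c ∷ xs≤cs) (y≤c ∷ ys≤cs) =
  cong₂ _∷_ (trans (interchange (c ∸ y) (c ∸ x) x y) (cong₂ _+_ (m∸n+n≡m y≤c) (m∸n+n≡m x≤c)))
            (exchange-sum xs≤cs ys≤cs)
  where
  interchange : ∀ m n o q → m + o + (n + q) ≡ m + q + (n + o)
  interchange = solve 4 (λ m n o q → m :+ o :+ (n :+ q) := m :+ q :+ (n :+ o)) refl

0≤½ : 0ℚ ≤ℚ ½
0≤½ = toWitness {a? = 0ℚ ≤ℚ? ½} _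

exchange-convComb : (π : Vec ℕ d) {T : ℕ} {c x y : Vec ℕ d} → InQ π T c →
  x ≤ᵛ c → y ≤ᵛ c → x ≢ y → dot π x ≡ dot π y → ConvCombOfOthers π T c
exchange-convComb π {T} {c} {x} {y} c∈Q x≤c y≤c x≢y πx≡πy =
  (½ , exchange c y x) ∷ (½ , exchange c x y) ∷ []
  , (0≤½ , inQ (dot-exchange π y≤c πx≡πy) , x≢y ∘ exchange-injective y≤c)
    ∷ (0≤½ , inQ (dot-exchange π x≤c (sym πx≡πy)) , x≢y ∘ sym ∘ exchange-injective x≤c)
    ∷ []
  , refl
  , midpoint-combo _ _ c (exchange-sum x≤c y≤c)
  where
  inQ : ∀ {c′} → dot π c′ ≡ dot π c → InQ π T c′
  inQ eq = subst (_≤ T) (sym eq) c∈Q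

-- Vertices are simple

indicatorValues : ℕ → List ℕ
indicatorValues zero    = [ 0 ]
indicatorValues (suc _) = 0 ∷ 1 ∷ []

supportIndicators : Vec ℕ d → List (Vec ℕ d)
supportIndicators []      = [ [] ]
supportIndicators (a ∷ c) = cartesianProductWith _∷_ (indicatorValues a) (supportIndicators c)

length-supportIndicators : (c : Vec ℕ d) → length (supportIndicators c) ≡ 2 ^ suppSize c
length-supportIndicators []          = refl
length-supportIndicators (zero ∷ c)  =
  trans (length-cartesianProductWith _∷_ [ 0 ] (supportIndicators c))
        (trans (+-identityʳ _) (length-supportIndicators c))
length-supportIndicators (suc _ ∷ c) =
  trans (length-cartesianProductWith _∷_ (0 ∷ 1 ∷ []) (supportIndicators c))
        (cong (2 *_) (length-supportIndicators c))

Unique-supportIndicators : (c : Vec ℕ d) → Unique (supportIndicators c)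
Unique-supportIndicators []      = [] ∷ []
Unique-supportIndicators (a ∷ c) =
  Unique.cartesianProductWith⁺ _∷_ ∷-injective (Unique-indicatorValues a) (Unique-supportIndicators c)
  where
  Unique-indicatorValues : ∀ a → Unique (indicatorValues a)
  Unique-indicatorValues zero    = [] ∷ []
  Unique-indicatorValues (suc _) = ((λ ()) ∷ []) ∷ [] ∷ []

supportIndicators-≤ᵛ : {c x : Vec ℕ d} → x ∈ supportIndicators c → x ≤ᵛ c
supportIndicators-≤ᵛ {c = []} (here refl) = []
supportIndicators-≤ᵛ {c = a ∷ c} x∈
  with v , x′ , v∈ , x′∈ , refl ← ∈-cartesianProductWith⁻ _∷_ (indicatorValues a) (supportIndicators c) x∈
  = indicatorValues-≤ v∈ ∷ supportIndicators-≤ᵛ x′∈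
  where
  indicatorValues-≤ : ∀ {v a} → v ∈ indicatorValues a → v ≤ a
  indicatorValues-≤ {a = zero}  (here refl)         = z≤n
  indicatorValues-≤ {a = suc _} (here refl)         = z≤n
  indicatorValues-≤ {a = suc _} (there (here refl)) = s≤s z≤n

vertex⇒simple : (π : Vec ℕ d) (T : ℕ) (c : Vec ℕ d) → IsVertex π T c → Simple T c
vertex⇒simple π T c (c∈Q , ¬convComb) = begin
  2 ^ suppSize c                               ≡⟨ length-supportIndicators c ⟨
  length (supportIndicators c)                 ≡⟨ length-map (dot π) (supportIndicators c) ⟨
  length (map (dot π) (supportIndicators c))   ≤⟨ Unique∧⊆⇒length≤ values! values⊆ ⟩
  length (upTo (suc T))                        ≡⟨ length-upTo (suc T) ⟩
  suc T                                        ≡⟨ +-comm 1 T ⟩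
  T + 1                                        ∎
  where
  open ≤-Reasoning
  injectiveOn : ∀ {x y} → x ∈ supportIndicators c → y ∈ supportIndicators c → dot π x ≡ dot π y → x ≡ y
  injectiveOn {x} {y} x∈ y∈ πx≡πy with ≡-dec _≟_ x y
  ... | yes x≡y = x≡y
  ... | no  x≢y = ⊥-elim (¬convComb
    (exchange-convComb π c∈Q (supportIndicators-≤ᵛ x∈) (supportIndicators-≤ᵛ y∈) x≢y πx≡πy))
  values! : Unique (map (dot π) (supportIndicators c))
  values! = Unique-map⁺-injectiveOn injectiveOn (Unique-supportIndicators c)
  values⊆ : map (dot π) (supportIndicators c) ⊆ upTo (suc T)
  values⊆ v∈ with x , x∈ , refl ← ∈-map⁻ (dot π) v∈ =
    ∈-upTo⁺ (s≤s (≤-trans (dot-monoʳ-≤ π (supportIndicators-≤ᵛ x∈)) c∈Q))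

-- Counting configurations of small support

sparseVectors : ℕ → (d k : ℕ) → List (Vec ℕ d)
sparseVectors T zero    k       = [ [] ]
sparseVectors T (suc d) zero    = map (0 ∷_) (sparseVectors T d zero)
sparseVectors T (suc d) (suc k) =
  map (0 ∷_) (sparseVectors T d (suc k)) ++ cartesianProductWith _∷_ (map suc (upTo T)) (sparseVectors T d k)

∈-sparseVectors : ∀ {T k} {c : Vec ℕ d} → Vecᴬ.All (_≤ T) c → suppSize c ≤ k → c ∈ sparseVectors T d k
∈-sparseVectors {c = []}    [] _ = here refl
∈-sparseVectors {k = zero}  {zero ∷ _} (_ ∷ c≤T) s≤k = ∈-map⁺ (0 ∷_) (∈-sparseVectors c≤T s≤k)
∈-sparseVectors {k = suc k} {zero ∷ _} (_ ∷ c≤T) s≤k =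
  ∈-++⁺ˡ (∈-map⁺ (0 ∷_) (∈-sparseVectors c≤T s≤k))
∈-sparseVectors {T = T} {k = suc k} {suc _ ∷ _} (x<T ∷ c≤T) (s≤s s≤k) =
  ∈-++⁺ʳ (map (0 ∷_) (sparseVectors T _ (suc k)))
    (∈-cartesianProductWith⁺ _∷_ (∈-map⁺ suc (∈-upTo⁺ x<T)) (∈-sparseVectors c≤T s≤k))

length-sparseVectors-suc : ∀ T d k → length (sparseVectors T (suc d) (suc k)) ≡
  length (sparseVectors T d (suc k)) + T * length (sparseVectors T d k)
length-sparseVectors-suc T d k = begin
  length (zeros ++ cartesianProductWith _∷_ positives (sparseVectors T d k))
    ≡⟨ length-++ zeros ⟩
  length zeros + length (cartesianProductWith _∷_ positives (sparseVectors T d k))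
    ≡⟨ cong₂ _+_ (length-map (0 ∷_) (sparseVectors T d (suc k)))
                 (length-cartesianProductWith _∷_ positives (sparseVectors T d k)) ⟩
  length (sparseVectors T d (suc k)) + length positives * length (sparseVectors T d k)
    ≡⟨ cong (λ n → length (sparseVectors T d (suc k)) + n * length (sparseVectors T d k))
            (trans (length-map suc (upTo T)) (length-upTo T)) ⟩
  length (sparseVectors T d (suc k)) + T * length (sparseVectors T d k) ∎
  where
  open ≡-Reasoning
  zeros     = map (0 ∷_) (sparseVectors T d (suc k))
  positives = map suc (upTo T)

length-sparseVectors : ∀ T d k → length (sparseVectors T d k) ≤ (1 + d * T) ^ k
length-sparseVectors T zero    k       = ≤-reflexive (sym (^-zeroˡ k))
length-sparseVectors T (suc d) zero    =
  ≤-trans (≤-reflexive (length-map (0 ∷_) (sparseVectors T d zero))) (length-sparseVectors T d zero)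
length-sparseVectors T (suc d) (suc k) = begin
  length (sparseVectors T (suc d) (suc k))
    ≡⟨ length-sparseVectors-suc T d k ⟩
  length (sparseVectors T d (suc k)) + T * length (sparseVectors T d k)
    ≤⟨ +-mono-≤ (length-sparseVectors T d (suc k)) (*-monoʳ-≤ T (length-sparseVectors T d k)) ⟩
  b * b ^ k + T * b ^ k   ≡⟨ *-distribʳ-+ (b ^ k) b T ⟨
  (b + T) * b ^ k         ≤⟨ *-monoʳ-≤ (b + T) (^-monoˡ-≤ k (m≤m+n b T)) ⟩
  (b + T) * (b + T) ^ k   ≡⟨ cong (λ n → suc n ^ suc k) (+-comm (d * T) T) ⟩
  (1 + suc d * T) ^ suc k ∎
  where
  open ≤-Reasoning
  b = 1 + d * T

Positive⇒entries≤dot : (π c : Vec ℕ d) → Positive π → Vecᴬ.All (_≤ dot π c) c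
Positive⇒entries≤dot []      []      _   = []
Positive⇒entries≤dot (p ∷ π) (x ∷ c) pos =
  ≤-trans x≤px (m≤m+n (p * x) (dot π c))
  ∷ Vecᴬ.map (λ y≤ → ≤-trans y≤ (m≤n+m (dot π c) (p * x))) (Positive⇒entries≤dot π c (pos ∘ Fin.suc))
  where
  x≤px : x ≤ p * x
  x≤px = ≤-trans (≤-reflexive (sym (*-identityˡ x))) (*-monoˡ-≤ x (pos Fin.zero))

-- Logarithmic bounds

n≤2^⌈log₂n⌉ : ∀ n → n ≤ 2 ^ ⌈log₂ n ⌉
n≤2^⌈log₂n⌉ n = bound-acc n (<-wellFounded n)
  where
  bound-acc : ∀ n (rec : Acc _<_ n) → n ≤ 2 ^ ⌈log2⌉ n rec
  bound-acc 0             _        = z≤n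
  bound-acc 1             _        = s≤s z≤n
  bound-acc (suc (suc n)) (acc rs) = begin
    2 + n                   ≤⟨ +-monoʳ-≤ 2 n≤h+h ⟩
    2 + (h + h)             ≡⟨ solve 1 (λ h → con 2 :+ (h :+ h) := con 2 :* (con 1 :+ h)) refl h ⟩
    2 * suc h               ≤⟨ *-monoʳ-≤ 2 (bound-acc (suc h) _) ⟩
    2 * 2 ^ ⌈log2⌉ (suc h) _ ∎
    where
    open ≤-Reasoning
    h = ⌈ n /2⌉
    n≤h+h : n ≤ h + h
    n≤h+h = subst (_≤ h + h) (⌊n/2⌋+⌈n/2⌉≡n n) (+-monoˡ-≤ h (⌊n/2⌋≤⌈n/2⌉ n))

2^m≤2^n⇒m≤n : ∀ {m n} → 2 ^ m ≤ 2 ^ n → m ≤ n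
2^m≤2^n⇒m≤n 2^m≤2^n = ≮⇒≥ λ n<m → <⇒≱ (^-monoʳ-< 2 (s≤s (s≤s z≤n)) n<m) 2^m≤2^n

simple⇒suppSize≤ : ∀ {T} (c : Vec ℕ d) → 1 ≤ T → Simple T c → suppSize c ≤ suc ⌈log₂ T ⌉
simple⇒suppSize≤ {T = T} c 1≤T simple = 2^m≤2^n⇒m≤n (begin
  2 ^ suppSize c     ≤⟨ simple ⟩
  T + 1              ≤⟨ +-monoʳ-≤ T 1≤T ⟩
  T + T              ≡⟨ cong (T +_) (+-identityʳ T) ⟨
  2 * T              ≤⟨ *-monoʳ-≤ 2 (n≤2^⌈log₂n⌉ T) ⟩
  2 ^ suc ⌈log₂ T ⌉  ∎)
  where open ≤-Reasoning

1+m*n≤2^[1+⌈log₂m⌉+⌈log₂n⌉] : ∀ {m n} → 1 ≤ m → 1 ≤ n →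
  1 + m * n ≤ 2 ^ suc (⌈log₂ m ⌉ + ⌈log₂ n ⌉)
1+m*n≤2^[1+⌈log₂m⌉+⌈log₂n⌉] {m} {n} 1≤m 1≤n = begin
  1 + m * n                       ≤⟨ +-monoˡ-≤ (m * n) (*-mono-≤ 1≤m 1≤n) ⟩
  m * n + m * n                   ≡⟨ cong (m * n +_) (+-identityʳ (m * n)) ⟨
  2 * (m * n)                     ≤⟨ *-monoʳ-≤ 2 (*-mono-≤ (n≤2^⌈log₂n⌉ m) (n≤2^⌈log₂n⌉ n)) ⟩
  2 * (2 ^ ⌈log₂ m ⌉ * 2 ^ ⌈log₂ n ⌉) ≡⟨ cong (2 *_) (^-distribˡ-+-* 2 ⌈log₂ m ⌉ ⌈log₂ n ⌉) ⟨
  2 ^ suc (⌈log₂ m ⌉ + ⌈log₂ n ⌉) ∎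
  where open ≤-Reasoning

exponent-bound : ∀ a b → suc (a + b) * suc b ≤ 4 * (b * b + a * a + 1)
exponent-bound a b = begin
  suc (a + b) * suc b
    ≡⟨ expand a b ⟩
  1 + a * b + a + b + b + b * b
    ≤⟨ +-monoˡ-≤ (b * b) (+-mono-≤ (+-mono-≤ (+-mono-≤ (+-monoʳ-≤ 1 (*≤squares a b))
                          (m≤m*m a)) (m≤m*m b)) (m≤m*m b)) ⟩
  1 + (a * a + b * b) + a * a + b * b + b * b + b * b
    ≤⟨ m≤m+n _ (3 + 2 * (a * a)) ⟩
  1 + (a * a + b * b) + a * a + b * b + b * b + b * b + (3 + 2 * (a * a))
    ≡⟨ collect a b ⟩
  4 * (b * b + a * a + 1) ∎
  where
  open ≤-Reasoning
  m≤m*m : ∀ m → m ≤ m * m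
  m≤m*m zero    = z≤n
  m≤m*m (suc m) = m≤m*n (suc m) (suc m)
  *≤squares : ∀ m n → m * n ≤ m * m + n * n
  *≤squares m n with ≤-total m n
  ... | inj₁ m≤n = ≤-trans (*-monoˡ-≤ n m≤n) (m≤n+m (n * n) (m * m))
  ... | inj₂ n≤m = ≤-trans (*-monoʳ-≤ m n≤m) (m≤m+n (m * m) (n * n))
  expand : ∀ a b → suc (a + b) * suc b ≡ 1 + a * b + a + b + b + b * b
  expand = solve 2 (λ a b →
    (con 1 :+ (a :+ b)) :* (con 1 :+ b) := con 1 :+ a :* b :+ a :+ b :+ b :+ b :* b) refl
  collect : ∀ a b → 1 + (a * a + b * b) + a * a + b * b + b * b + b * b + (3 + 2 * (a * a)) ≡
                    4 * (b * b + a * a + 1)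
  collect = solve 2 (λ a b →
    con 1 :+ (a :* a :+ b :* b) :+ a :* a :+ b :* b :+ b :* b :+ b :* b :+ (con 3 :+ con 2 :* (a :* a))
    := con 4 :* (b :* b :+ a :* a :+ con 1)) refl

[1+d*T]^[1+⌈log₂T⌉]≤bound : ∀ {d T} → 1 ≤ d → 1 ≤ T → (1 + d * T) ^ suc ⌈log₂ T ⌉ ≤ bound 4 T d
[1+d*T]^[1+⌈log₂T⌉]≤bound {d} {T} 1≤d 1≤T = begin
  (1 + d * T) ^ suc b        ≤⟨ ^-monoˡ-≤ (suc b) (1+m*n≤2^[1+⌈log₂m⌉+⌈log₂n⌉] 1≤d 1≤T) ⟩
  (2 ^ suc (a + b)) ^ suc b  ≡⟨ ^-*-assoc 2 (suc (a + b)) (suc b) ⟩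
  2 ^ (suc (a + b) * suc b)  ≤⟨ ^-monoʳ-≤ 2 (exponent-bound a b) ⟩
  bound 4 T d                ∎
  where
  open ≤-Reasoning
  a = ⌈log₂ d ⌉
  b = ⌈log₂ T ⌉

AtMost-mono : ∀ {P : Vec ℕ d → Set} {B B′} → B ≤ B′ → AtMost P B → AtMost P B′
AtMost-mono B≤B′ atMost L L! L-P = ≤-trans (atMost L L! L-P) B≤B′

AtMost-⊆ : ∀ {P Q : Vec ℕ d → Set} {B} → (∀ {c} → P c → Q c) → AtMost Q B → AtMost P B
AtMost-⊆ P⇒Q atMost L L! L-P = atMost L L! (All.map P⇒Q L-P)

simple-count : (π : Vec ℕ d) (T : ℕ) → Positive π → 1 ≤ T →
  AtMost (λ c → InQ π T c × Simple T c) ((1 + d * T) ^ suc ⌈log₂ T ⌉)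
simple-count {d} π T pos 1≤T L L! L-simple =
  ≤-trans (Unique∧⊆⇒length≤ L! L⊆) (length-sparseVectors T d (suc ⌈log₂ T ⌉))
  where
  L⊆ : L ⊆ sparseVectors T d (suc ⌈log₂ T ⌉)
  L⊆ {c} c∈L with c∈Q , simple ← All.lookup L-simple c∈L =
    ∈-sparseVectors (Vecᴬ.map (λ x≤πc → ≤-trans x≤πc c∈Q) (Positive⇒entries≤dot π c pos))
                    (simple⇒suppSize≤ c 1≤T simple)

corollary5 : ((d : ℕ) → 1 ≤ d → (π : Vec ℕ d) → Positive π → (T : ℕ) → 1 ≤ T →
    (c : Vec ℕ d) → IsVertex π T c → Simple T c)
    × Σ ℕ (λ C → (d : ℕ) → 1 ≤ d → (π : Vec ℕ d) → Positive π → (T : ℕ) → 1 ≤ T →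
    AtMost (λ c → InQ π T c × Simple T c) (bound C T d))
    × Σ ℕ (λ C → (d : ℕ) → 1 ≤ d → (π : Vec ℕ d) → Positive π → (T : ℕ) → 1 ≤ T →
    AtMost (IsVertex π T) (bound C T d))
corollary5 =
  (λ _ _ π _ T _ → vertex⇒simple π T)
  , (4 , simple-bound)
  , (4 , λ d 1≤d π pos T 1≤T →
         AtMost-⊆ (λ {c} v → proj₁ v , vertex⇒simple π T c v) (simple-bound d 1≤d π pos T 1≤T))
  where
  simple-bound : (d : ℕ) → 1 ≤ d → (π : Vec ℕ d) → Positive π → (T : ℕ) → 1 ≤ T →
    AtMost (λ c → InQ π T c × Simple T c) (bound 4 T d)
  simple-bound d 1≤d π pos T 1≤T =
    AtMost-mono ([1+d*T]^[1+⌈log₂T⌉]≤bound 1≤d 1≤T) (simple-count π T pos 1≤T)
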